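{- Let $k\ge 6$ be an integer divisible by $3$, let $s$ be a positive integer and let $j=2k/3$. Then the circle graph $D$ on $n=2sk+1$ vertices determined by $\{(j-2)s+2,(j-2)s+4,\ldots,js\}$ (the integers $x$ with $(j-2)s+2\le x\le js$ and $x\equiv (j-2)s+2 \pmod 2$) has no diameter two subgraph containing more than $2s+5$ vertices.
   Context: For an integer $n\ge 2$ and a set $S\subseteq\{1,\ldots,\lfloor n/2\rfloor\}$, the circle graph on $n$ vertices determined by $S$ is the graph with vertex set $\{0,1,\ldots,n-1\}$ in which two vertices $x,y$ are adjacent if and only if $(x-y)\bmod n\in S$ or $(y-x)\bmod n\in S$. A diameter two subgraph of a graph $G$ is a subgraph $H$ of $G$ such that for every pair of vertices $x,y$ of $H$ there is a path in $H$ joining $x$ and $y$ with at most two edges. -}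

module Defs where

open import Level using (0ℓ)
open import Data.Nat using (ℕ; suc; _+_; _*_; _∸_; _≤_; _<_; NonZero)
open import Data.Nat.DivMod using (_%_; _/_)
open import Data.Fin using (Fin; toℕ)
open import Data.Product using (Σ; _×_; ∃-syntax)
open import Data.Sum using (_⊎_)
open import Data.List using (List; length)
open import Data.List.Membership.Propositional using (_∈_)
open import Data.List.Relation.Unary.Unique.Propositional using (Unique)
open import Relation.Binary.PropositionalEquality using (_≡_)

CircleAdj : (n : ℕ) → .{{_ : NonZero n}} → (ℕ → Set) → Fin n → Fin n → Set
CircleAdj n S x y = S ((toℕ x + n ∸ toℕ y) % n) ⊎ S ((toℕ y + n ∸ toℕ x) % n)

record Subgraph {V : Set} (Adj : V → V → Set) : Set₁ where
  field
    verts    : List V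
    distinct : Unique verts
    Edge     : V → V → Set
    sym      : ∀ {x y} → Edge x y → Edge y x
    edge-inˡ : ∀ {x y} → Edge x y → x ∈ verts
    edge-inʳ : ∀ {x y} → Edge x y → y ∈ verts
    edge-G   : ∀ {x y} → Edge x y → Adj x y

DiameterTwo : {V : Set} {Adj : V → V → Set} → Subgraph Adj → Set
DiameterTwo {V} H = ∀ x y → x ∈ verts → y ∈ verts →
    x ≡ y ⊎ Edge x y ⊎ (∃[ z ] (Edge x z × Edge z y))
  where open Subgraph H

Sset : (j s : ℕ) → ℕ → Set
Sset j s x = ((j ∸ 2) * s + 2 ≤ x) × (x ≤ j * s) × (x % 2 ≡ ((j ∸ 2) * s + 2) % 2)

D : (k s : ℕ) → Fin (suc (2 * s * k)) → Fin (suc (2 * s * k)) → Set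
D k s = CircleAdj (suc (2 * s * k)) (Sset ((2 * k) / 3) s)

{-# OPTIONS --safe #-}
-- Write t = (k/3 − 2)s. The connections of D are the even numbers 2h with s + t < h ≤ 2s + t,
-- and n = 6(2s + t) + 1 is odd, so clockwise gaps between vertices can be measured in halves.
-- If two vertices are joined by a path of at most two edges, the half-gap between them in one
-- of the two directions lies in Near = [0, s) ∪ (s + t, 2s + t] ∪ [2s + 2t + 2, 4s + 2t]
-- (differences, single connections and sums of two connections). Three such half-gaps add up
-- to less than n, which is odd, so they close a cycle only when all vanish; hence a diameter-two
-- subgraph contains a vertex a from which every vertex lies at a half-gap in Near. Near is
-- covered by 2s + 1 fibres whose members differ by s or s + t, and two vertices whose half-gaps
-- from a differ by s or s + t are not within distance two: s and s + t are not in Near, and the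
-- other direction would close a cycle of small half-gaps. So the subgraph has at most 2s + 1
-- vertices.

module Submission where

open import Data.Fin as Fin using (Fin; zero; suc; toℕ; fromℕ<)
open import Data.Fin.Properties using (toℕ-injective; toℕ<n; fromℕ<-injective; pigeonhole)
  renaming (<⇒≢ to <⇒≢ᶠ)
open import Data.List using (List; []; _∷_; length; lookup)
open import Data.List.Membership.Propositional using (_∈_)
open import Data.List.Membership.Propositional.Properties using (∈-lookup)
open import Data.List.Relation.Unary.All as All using ()
open import Data.List.Relation.Unary.Any using (here; there)
open import Data.List.Relation.Unary.AllPairs using (_∷_)
open import Data.List.Relation.Unary.Unique.Propositional using (Unique)
open import Data.Nat
open import Data.Nat.Divisibility using (_∣_; divides)
open import Data.Nat.DivMod
open import Data.Nat.Properties
open import Data.Nat.Tactic.RingSolver using (solve)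
open import Data.Product using (∃-syntax; _×_; _,_; proj₁; proj₂)
open import Data.Sum using (_⊎_; inj₁; inj₂)
open import Relation.Binary.PropositionalEquality
open import Relation.Nullary using (¬_; yes; no; contradiction)

open import Defs

m+k≡n⇒m≤n : ∀ {m n} k → m + k ≡ n → m ≤ n
m+k≡n⇒m≤n {m} k refl = m≤m+n m k

module _ {A : Set} where

  lookup-injective : ∀ {xs : List A} → Unique xs → ∀ {i j} → lookup xs i ≡ lookup xs j → i ≡ j
  lookup-injective (_ ∷ _)      {zero}  {zero}  _  = refl
  lookup-injective (x∉xs ∷ _)   {zero}  {suc j} eq = contradiction eq       (All.lookup x∉xs (∈-lookup j))
  lookup-injective (x∉xs ∷ _)   {suc i} {zero}  eq = contradiction (sym eq) (All.lookup x∉xs (∈-lookup i))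
  lookup-injective (_ ∷ unique) {suc i} {suc j} eq = cong Fin.suc (lookup-injective unique eq)

  length≤-injectiveOn : ∀ {B} (f : A → ℕ) {xs : List A} → Unique xs →
    (∀ {x} → x ∈ xs → f x < B) →
    (∀ {x y} → x ∈ xs → y ∈ xs → f x ≡ f y → x ≡ y) →
    length xs ≤ B
  length≤-injectiveOn {B} f {xs} unique f<B f-inj with length xs ≤? B
  ... | yes ≤B = ≤B
  ... | no ≰B with pigeonhole (≰⇒> ≰B) (λ i → fromℕ< (f<B (∈-lookup i)))
  ...   | i , j , i<j , eq = contradiction
          (lookup-injective unique (f-inj (∈-lookup i) (∈-lookup j) (fromℕ<-injective _ _ _ _ eq)))
          (<⇒≢ᶠ i<j)

module _ {A : Set} (R : A → A → Set) (R-refl : ∀ x → R x x)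
         (R-cycle : ∀ {x w y} → R x w → R w y → R y x → x ≡ y) where

  ∃-least : ∀ x xs → (∀ {u v} → u ∈ x ∷ xs → v ∈ x ∷ xs → R u v ⊎ R v u) →
            ∃[ a ] (a ∈ x ∷ xs × ∀ {y} → y ∈ x ∷ xs → R a y)
  ∃-least x [] _ = x , here refl , λ { (here refl) → R-refl x }
  ∃-least x (y ∷ ys) total with ∃-least y ys (λ u∈ v∈ → total (there u∈) (there v∈))
  ... | a , a∈ , a≤ with total (here refl) (there a∈)
  ...   | inj₂ a≤x = a , there a∈ , λ { (here refl) → a≤x ; (there z∈) → a≤ z∈ }
  ...   | inj₁ x≤a = x , here refl , x≤
    where
    x≤ : ∀ {z} → z ∈ x ∷ y ∷ ys → R x z
    x≤ (here refl) = R-refl x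
    x≤ (there z∈) with total (here refl) (there z∈)
    ... | inj₁ x≤z = x≤z
    ... | inj₂ z≤x = subst (R x) (R-cycle x≤a (a≤ z∈) z≤x) (R-refl x)

2*h%[1+2m]≡0⇒h≡0 : ∀ {n} m h .{{_ : NonZero n}} → n ≡ suc (2 * m) → h ≤ 2 * m →
                   (2 * h) % n ≡ 0 → h ≡ 0
2*h%[1+2m]≡0⇒h≡0 {n} m h refl h≤2m 2h%n≡0 =
  by-quotient (2 * h / n) (trans (m≡m%n+[m/n]*n (2 * h) n) (cong (_+ 2 * h / n * n) 2h%n≡0))
  where
  by-quotient : ∀ q → 2 * h ≡ q * n → h ≡ 0
  by-quotient zero          eq = m+n≡0⇒m≡0 h eq
  by-quotient (suc zero)    eq = contradiction (trans eq (+-identityʳ n)) (even≢odd h m)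
  by-quotient (suc (suc q)) eq = contradiction 2h<n+n (≤⇒≯ n+n≤2h)
    where
    n+n≤2h : n + n ≤ 2 * h
    n+n≤2h = subst (n + n ≤_) (sym eq) (+-monoʳ-≤ n (m≤m+n n (q * n)))
    4m<n+n : 2 * (2 * m) < n + n
    4m<n+n = m+k≡n⇒m≤n 1 (solve (m ∷ []))
    2h<n+n : 2 * h < n + n
    2h<n+n = ≤-trans (s≤s (*-monoʳ-≤ 2 h≤2m)) 4m<n+n

/2-twice : ∀ {d h} → d ≡ 2 * h → d / 2 ≡ h
/2-twice {h = h} refl = trans (cong (_/ 2) (*-comm 2 h)) (m*n/n≡m h 2)

Twice : (ℕ → Set) → ℕ → Set
Twice P d = ∃[ h ] (d ≡ 2 * h × P h)

-- j is written as 2 + i so that the lower end (j ∸ 2) * s + 2 of the connection set computes.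
Sset⇒Twice : ∀ {i s c w d} → i * s + 2 ≡ 2 * suc c → suc (suc i) * s ≡ 2 * w →
             Sset (suc (suc i)) s d → Twice (λ h → c < h × h ≤ w) d
Sset⇒Twice {i} {s} {c} {w} {d} lo≡ hi≡ (lo , hi , parity) =
  d / 2 , d≡2[d/2] ,
  *-cancelˡ-≤ 2 (subst₂ _≤_ lo≡ d≡2[d/2] lo) , *-cancelˡ-≤ 2 (subst₂ _≤_ d≡2[d/2] hi≡ hi)
  where
  d%2≡0 : d % 2 ≡ 0
  d%2≡0 = trans parity (trans (cong (_% 2) (trans lo≡ (*-comm 2 (suc c)))) (m*n%n≡0 (suc c) 2))
  d≡2[d/2] : d ≡ 2 * (d / 2)
  d≡2[d/2] = trans (m≡m%n+[m/n]*n d 2) (trans (cong (_+ d / 2 * 2) d%2≡0) (*-comm (d / 2) 2))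

module Clockwise (n : ℕ) .{{_ : NonZero n}} where

  record Step (x : Fin n) (d : ℕ) (y : Fin n) : Set where
    constructor step
    field arrives : (toℕ x + d) % n ≡ toℕ y

  gap : Fin n → Fin n → ℕ
  gap x y = (toℕ y + n ∸ toℕ x) % n

  [m%n+k]%n≡[m+k]%n : ∀ m k → (m % n + k) % n ≡ (m + k) % n
  [m%n+k]%n≡[m+k]%n m k = begin
    (m % n + k) % n          ≡⟨ %-distribˡ-+ (m % n) k n ⟩
    (m % n % n + k % n) % n  ≡⟨ cong (λ r → (r + k % n) % n) (m%n%n≡m%n m n) ⟩
    (m % n + k % n) % n      ≡⟨ %-distribˡ-+ m k n ⟨
    (m + k) % n              ∎
    where open ≡-Reasoning

  [k+m]%n≡[k+o]%n⇒m%n≡o%n : ∀ k m o → (k + m) % n ≡ (k + o) % n → m % n ≡ o % n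
  [k+m]%n≡[k+o]%n⇒m%n≡o%n k m o eq = begin
    m % n                           ≡⟨ undo-k m ⟨
    ((k + m) % n + (n ∸ k % n)) % n ≡⟨ cong (λ r → (r + (n ∸ k % n)) % n) eq ⟩
    ((k + o) % n + (n ∸ k % n)) % n ≡⟨ undo-k o ⟩
    o % n                           ∎
    where
    open ≡-Reasoning
    k+[n∸k%n]≡[1+k/n]*n : k + (n ∸ k % n) ≡ suc (k / n) * n
    k+[n∸k%n]≡[1+k/n]*n = begin
      k + (n ∸ k % n)                    ≡⟨ cong (_+ (n ∸ k % n)) (m≡m%n+[m/n]*n k n) ⟩
      k % n + k / n * n + (n ∸ k % n)    ≡⟨ cong (_+ (n ∸ k % n)) (+-comm (k % n) (k / n * n)) ⟩
      k / n * n + k % n + (n ∸ k % n)    ≡⟨ +-assoc (k / n * n) (k % n) (n ∸ k % n) ⟩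
      k / n * n + (k % n + (n ∸ k % n))  ≡⟨ cong (k / n * n +_) (m+[n∸m]≡n (m%n≤n k n)) ⟩
      k / n * n + n                      ≡⟨ +-comm (k / n * n) n ⟩
      suc (k / n) * n                    ∎
    undo-k : ∀ m → ((k + m) % n + (n ∸ k % n)) % n ≡ m % n
    undo-k m = begin
      ((k + m) % n + (n ∸ k % n)) % n ≡⟨ [m%n+k]%n≡[m+k]%n (k + m) (n ∸ k % n) ⟩
      (k + m + (n ∸ k % n)) % n       ≡⟨ cong (λ r → (r + (n ∸ k % n)) % n) (+-comm k m) ⟩
      (m + k + (n ∸ k % n)) % n       ≡⟨ cong (_% n) (+-assoc m k (n ∸ k % n)) ⟩
      (m + (k + (n ∸ k % n))) % n     ≡⟨ cong (λ r → (m + r) % n) k+[n∸k%n]≡[1+k/n]*n ⟩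
      (m + suc (k / n) * n) % n       ≡⟨ [m+kn]%n≡m%n m (suc (k / n)) n ⟩
      m % n                           ∎

  toℕ%n : ∀ (x : Fin n) → toℕ x % n ≡ toℕ x
  toℕ%n x = m<n⇒m%n≡m (toℕ<n x)

  [x+0]%n≡x : ∀ (x : Fin n) → (toℕ x + 0) % n ≡ toℕ x
  [x+0]%n≡x x = trans (cong (_% n) (+-identityʳ (toℕ x))) (toℕ%n x)

  step-gap : ∀ x y → Step x (gap x y) y
  step-gap x y = step (begin
    (toℕ x + g % n) % n  ≡⟨ cong (_% n) (+-comm (toℕ x) (g % n)) ⟩
    (g % n + toℕ x) % n  ≡⟨ [m%n+k]%n≡[m+k]%n g (toℕ x) ⟩
    (g + toℕ x) % n      ≡⟨ cong (_% n) (m∸n+n≡m x≤y+n) ⟩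
    (toℕ y + n) % n      ≡⟨ [m+n]%n≡m%n (toℕ y) n ⟩
    toℕ y % n            ≡⟨ toℕ%n y ⟩
    toℕ y                ∎)
    where
    open ≡-Reasoning
    g = toℕ y + n ∸ toℕ x
    x≤y+n : toℕ x ≤ toℕ y + n
    x≤y+n = ≤-trans (<⇒≤ (toℕ<n x)) (m≤n+m n (toℕ y))

  gap≡⇒step : ∀ {x y d} → gap x y ≡ d → Step x d y
  gap≡⇒step {x} {y} refl = step-gap x y

  gap-self : ∀ x → gap x x ≡ 0
  gap-self x = trans (cong (_% n) (m+n∸m≡n (toℕ x) n)) (n%n≡0 n)

  step-unique : ∀ {x y d e} → d < n → e < n → Step x d y → Step x e y → d ≡ e
  step-unique {x} {d = d} {e} d<n e<n (step p) (step q) = begin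
    d      ≡⟨ m<n⇒m%n≡m d<n ⟨
    d % n  ≡⟨ [k+m]%n≡[k+o]%n⇒m%n≡o%n (toℕ x) d e (trans p (sym q)) ⟩
    e % n  ≡⟨ m<n⇒m%n≡m e<n ⟩
    e      ∎
    where open ≡-Reasoning

  gap-unique : ∀ {x y d} → d < n → Step x d y → gap x y ≡ d
  gap-unique {x} {y} d<n = step-unique (m%n<n _ n) d<n (step-gap x y)

  gap-injectiveʳ : ∀ {x y z} → gap x y ≡ gap x z → y ≡ z
  gap-injectiveʳ {x} {y} eq =
    toℕ-injective (trans (sym (Step.arrives (step-gap x y))) (Step.arrives (gap≡⇒step (sym eq))))

  step-zero : ∀ {x y} → Step x 0 y → x ≡ y
  step-zero {x} (step p) = toℕ-injective (trans (sym ([x+0]%n≡x x)) p)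

  step-trans : ∀ {x y z a b} → Step x a y → Step y b z → Step x (a + b) z
  step-trans {x} {y} {z} {a} {b} (step p) (step q) = step (begin
    (toℕ x + (a + b)) % n      ≡⟨ cong (_% n) (+-assoc (toℕ x) a b) ⟨
    (toℕ x + a + b) % n        ≡⟨ [m%n+k]%n≡[m+k]%n (toℕ x + a) b ⟨
    ((toℕ x + a) % n + b) % n  ≡⟨ cong (λ r → (r + b) % n) p ⟩
    (toℕ y + b) % n            ≡⟨ q ⟩
    toℕ z                      ∎)
    where open ≡-Reasoning

  step-diverging : ∀ {w x y a b} → a ≤ b → Step w a x → Step w b y → Step x (b ∸ a) y
  step-diverging {w} {x} {y} {a} {b} a≤b (step p) (step q) = step (begin
    (toℕ x + (b ∸ a)) % n            ≡⟨ cong (λ r → (r + (b ∸ a)) % n) p ⟨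
    ((toℕ w + a) % n + (b ∸ a)) % n  ≡⟨ [m%n+k]%n≡[m+k]%n (toℕ w + a) (b ∸ a) ⟩
    (toℕ w + a + (b ∸ a)) % n        ≡⟨ cong (_% n) (+-assoc (toℕ w) a (b ∸ a)) ⟩
    (toℕ w + (a + (b ∸ a))) % n      ≡⟨ cong (λ r → (toℕ w + r) % n) (m+[n∸m]≡n a≤b) ⟩
    (toℕ w + b) % n                  ≡⟨ q ⟩
    toℕ y                            ∎)
    where open ≡-Reasoning

  step-converging : ∀ {w x y a b} → b ≤ a → Step x a w → Step y b w → Step x (a ∸ b) y
  step-converging {w} {x} {y} {a} {b} b≤a (step p) (step q) = step (begin
    (toℕ x + (a ∸ b)) % n  ≡⟨ [k+m]%n≡[k+o]%n⇒m%n≡o%n b _ (toℕ y) b+[x+[a∸b]]≡b+y ⟩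
    toℕ y % n              ≡⟨ toℕ%n y ⟩
    toℕ y                  ∎)
    where
    open ≡-Reasoning
    b+[x+[a∸b]]≡b+y : (b + (toℕ x + (a ∸ b))) % n ≡ (b + toℕ y) % n
    b+[x+[a∸b]]≡b+y = begin
      (b + (toℕ x + (a ∸ b))) % n  ≡⟨ cong (_% n) (+-comm b (toℕ x + (a ∸ b))) ⟩
      (toℕ x + (a ∸ b) + b) % n    ≡⟨ cong (_% n) (+-assoc (toℕ x) (a ∸ b) b) ⟩
      (toℕ x + (a ∸ b + b)) % n    ≡⟨ cong (λ r → (toℕ x + r) % n) (m∸n+n≡m b≤a) ⟩
      (toℕ x + a) % n              ≡⟨ trans p (sym q) ⟩
      (toℕ y + b) % n              ≡⟨ cong (_% n) (+-comm (toℕ y) b) ⟩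
      (b + toℕ y) % n              ∎

  step-loop : ∀ {x d} → Step x d x → d % n ≡ 0
  step-loop {x} {d} (step p) = trans
    ([k+m]%n≡[k+o]%n⇒m%n≡o%n (toℕ x) d 0 (trans p (sym ([x+0]%n≡x x))))
    (m*n%n≡0 0 n)

module HalfGaps (s t n : ℕ) .{{_ : NonZero n}} (0<s : 0 < s)
                (n≡ : n ≡ suc (2 * (3 * (2 * s + t)))) where

  open Clockwise n public

  Connecting : ℕ → Set
  Connecting h = s + t < h × h ≤ 2 * s + t

  data Near (h : ℕ) : Set where
    difference : h < s → Near h
    connection : Connecting h → Near h
    sum        : 2 * suc (s + t) ≤ h → h ≤ 2 * (2 * s + t) → Near h

  s≤2s : s ≤ 2 * s
  s≤2s = m≤m+n s (s + 0)

  s≤2s+t : s ≤ 2 * s + t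
  s≤2s+t = ≤-trans s≤2s (m≤m+n (2 * s) t)

  2s+t≤2[2s+t] : 2 * s + t ≤ 2 * (2 * s + t)
  2s+t≤2[2s+t] = m≤m+n (2 * s + t) (2 * s + t + 0)

  Adjacent : Fin n → Fin n → Set
  Adjacent x y = Twice Connecting (gap y x) ⊎ Twice Connecting (gap x y)

  infix 4 _⇝_
  _⇝_ : Fin n → Fin n → Set
  x ⇝ y = Twice Near (gap x y)

  near≤ : ∀ {h} → Near h → h ≤ 2 * (2 * s + t)
  near≤ (difference h<s)      = ≤-trans (<⇒≤ h<s) (≤-trans s≤2s+t 2s+t≤2[2s+t])
  near≤ (connection (_ , h≤)) = ≤-trans h≤ 2s+t≤2[2s+t]
  near≤ (sum _ h≤)            = h≤

  connecting-sum : ∀ {a b} → Connecting a → Connecting b → Near (a + b)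
  connecting-sum {a} {b} (s+t<a , a≤) (s+t<b , b≤) =
    sum (subst (_≤ a + b) lo≡ (+-mono-≤ s+t<a s+t<b)) (subst (a + b ≤_) hi≡ (+-mono-≤ a≤ b≤))
    where
    lo≡ : suc (s + t) + suc (s + t) ≡ 2 * suc (s + t)
    lo≡ = solve (s ∷ t ∷ [])
    hi≡ : 2 * s + t + (2 * s + t) ≡ 2 * (2 * s + t)
    hi≡ = solve (s ∷ t ∷ [])

  connecting-diff : ∀ {a b} → Connecting a → Connecting b → a ∸ b < s
  connecting-diff {a} {b} (_ , a≤) (s+t<b , _) =
    m<n+o⇒m∸n<o a b {{>-nonZero 0<s}} (≤-trans (s≤s a≤) a+1≤b+s)
    where
    a+1≤b+s : suc (2 * s + t) ≤ b + s
    a+1≤b+s = subst (_≤ b + s) eq (+-monoˡ-≤ s s+t<b)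
      where
      eq : suc (s + t) + s ≡ suc (2 * s + t)
      eq = solve (s ∷ t ∷ [])

  2*h<n : ∀ {h} → h ≤ 2 * (2 * s + t) → 2 * h < n
  2*h<n {h} h≤ =
    subst (2 * h <_) (sym n≡) (s≤s (*-monoʳ-≤ 2 (≤-trans h≤ 2[2s+t]≤3[2s+t])))
    where
    2[2s+t]≤3[2s+t] : 2 * (2 * s + t) ≤ 3 * (2 * s + t)
    2[2s+t]≤3[2s+t] = m≤n+m (2 * (2 * s + t)) (2 * s + t)

  step⇒⇝ : ∀ {x y h} → Step x (2 * h) y → Near h → x ⇝ y
  step⇒⇝ {h = h} p near = h , gap-unique (2*h<n (near≤ near)) p , near

  ⇝-refl : ∀ {x} → x ⇝ x
  ⇝-refl {x} = 0 , gap-self x , difference 0<s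

  adjacent⇒comparable : ∀ {x y} → Adjacent x y → x ⇝ y ⊎ y ⇝ x
  adjacent⇒comparable (inj₁ (h , eq , c)) = inj₂ (h , eq , connection c)
  adjacent⇒comparable (inj₂ (h , eq , c)) = inj₁ (h , eq , connection c)

  consecutive⇒⇝ : ∀ {x w y} → Twice Connecting (gap x w) → Twice Connecting (gap w y) → x ⇝ y
  consecutive⇒⇝ {x} {w} {y} (a , p , ca) (b , q , cb) =
    step⇒⇝ (subst (λ d → Step x d y) (sym (*-distribˡ-+ 2 a b))
                  (step-trans (gap≡⇒step p) (gap≡⇒step q)))
           (connecting-sum ca cb)

  converging⇒⇝ : ∀ {x y w a b} → b ≤ a → gap x w ≡ 2 * a → gap y w ≡ 2 * b →
                 Connecting a → Connecting b → x ⇝ y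
  converging⇒⇝ {x} {y} {a = a} {b} b≤a p q ca cb =
    step⇒⇝ (subst (λ d → Step x d y) (sym (*-distribˡ-∸ 2 a b))
                  (step-converging (*-monoʳ-≤ 2 b≤a) (gap≡⇒step p) (gap≡⇒step q)))
           (difference (connecting-diff ca cb))

  diverging⇒⇝ : ∀ {x y w a b} → a ≤ b → gap w x ≡ 2 * a → gap w y ≡ 2 * b →
                Connecting a → Connecting b → x ⇝ y
  diverging⇒⇝ {x} {y} {w} {a} {b} a≤b p q ca cb =
    step⇒⇝ (subst (λ d → Step x d y) (sym (*-distribˡ-∸ 2 b a))
                  (step-diverging (*-monoʳ-≤ 2 a≤b) (gap≡⇒step {w} p) (gap≡⇒step {w} q)))
           (difference (connecting-diff cb ca))

  path⇒comparable : ∀ {x w y} → Adjacent x w → Adjacent w y → x ⇝ y ⊎ y ⇝ x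
  path⇒comparable {x} {w} {y} (inj₂ xw) (inj₂ wy) = inj₁ (consecutive⇒⇝ {x} {w} {y} xw wy)
  path⇒comparable {x} {w} {y} (inj₁ wx) (inj₁ yw) = inj₂ (consecutive⇒⇝ {y} {w} {x} yw wx)
  path⇒comparable {x} {w} {y} (inj₂ (a , p , ca)) (inj₁ (b , q , cb)) with ≤-total a b
  ... | inj₁ a≤b = inj₂ (converging⇒⇝ {y} {x} {w} a≤b q p cb ca)
  ... | inj₂ b≤a = inj₁ (converging⇒⇝ {x} {y} {w} b≤a p q ca cb)
  path⇒comparable {x} {w} {y} (inj₁ (a , p , ca)) (inj₂ (b , q , cb)) with ≤-total a b
  ... | inj₁ a≤b = inj₁ (diverging⇒⇝ {x} {y} {w} a≤b p q ca cb)
  ... | inj₂ b≤a = inj₂ (diverging⇒⇝ {y} {x} {w} b≤a q p cb ca)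

  short-loop : ∀ {x h} → Step x (2 * h) x → h ≤ 2 * (3 * (2 * s + t)) → h ≡ 0
  short-loop {h = h} p h≤ = 2*h%[1+2m]≡0⇒h≡0 (3 * (2 * s + t)) h n≡ h≤ (step-loop p)

  ⇝-cycle : ∀ {x w y} → x ⇝ w → w ⇝ y → y ⇝ x → x ≡ y
  ⇝-cycle {x} {w} {y} (a , p , na) (b , q , nb) (c , r , nc) =
    sym (step-zero (gap≡⇒step (trans r (cong (2 *_) (m+n≡0⇒n≡0 (a + b) a+b+c≡0)))))
    where
    loop : Step x (2 * (a + b + c)) x
    loop = subst (λ d → Step x d x) sum≡
             (step-trans (step-trans (gap≡⇒step p) (gap≡⇒step q)) (gap≡⇒step r))
      where
      sum≡ : 2 * a + 2 * b + 2 * c ≡ 2 * (a + b + c)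
      sum≡ = solve (a ∷ b ∷ c ∷ [])
    a+b+c≡0 : a + b + c ≡ 0
    a+b+c≡0 = short-loop loop
      (subst (a + b + c ≤_) three≡ (+-mono-≤ (+-mono-≤ (near≤ na) (near≤ nb)) (near≤ nc)))
      where
      three≡ : 2 * (2 * s + t) + 2 * (2 * s + t) + 2 * (2 * s + t) ≡ 2 * (3 * (2 * s + t))
      three≡ = solve (s ∷ t ∷ [])

  Jump : ℕ → Set
  Jump e = e ≡ s ⊎ e ≡ s + t

  jump-not-near : ∀ {e} → Jump e → ¬ Near e
  jump-not-near (inj₁ refl) (difference e<s)       = <-irrefl refl e<s
  jump-not-near (inj₁ refl) (connection (s+t<s , _)) = <⇒≱ s+t<s (m≤m+n s t)
  jump-not-near (inj₁ refl) (sum lo _)             =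
    <⇒≱ (≤-trans (s≤s (m≤m+n s t)) (m≤m+n (suc (s + t)) (suc (s + t) + 0))) lo
  jump-not-near (inj₂ refl) (difference s+t<s)     = <⇒≱ s+t<s (m≤m+n s t)
  jump-not-near (inj₂ refl) (connection (s+t<s+t , _)) = <-irrefl refl s+t<s+t
  jump-not-near (inj₂ refl) (sum lo _)             = <⇒≱ (m≤m+n (suc (s + t)) (suc (s + t) + 0)) lo

  jump≤ : ∀ {e} → Jump e → e ≤ 2 * s + t
  jump≤ (inj₁ refl) = s≤2s+t
  jump≤ (inj₂ refl) = +-monoˡ-≤ t s≤2s

  jump>0 : ∀ {e} → Jump e → 0 < e
  jump>0 (inj₁ refl) = 0<s
  jump>0 (inj₂ refl) = ≤-trans 0<s (m≤m+n s t)

  Apart : ℕ → ℕ → Set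
  Apart h₁ h₂ = ∃[ e ] (Jump e × h₂ ≡ h₁ + e)

  apart⇒incomparable : ∀ {a y z h₁ h₂} → gap a y ≡ 2 * h₁ → gap a z ≡ 2 * h₂ →
                       Apart h₁ h₂ → ¬ (y ⇝ z ⊎ z ⇝ y)
  apart⇒incomparable {a} {y} {z} {h₁} p q (e , jump , refl) = λ
    { (inj₁ (h , r , near)) →
        jump-not-near jump (subst Near (*-cancelˡ-≡ h e 2 (trans (sym r) gap≡2e)) near)
    ; (inj₂ (h , r , near)) → <⇒≢ (jump>0 jump) (sym (m+n≡0⇒m≡0 e (e+h≡0 r near)))
    }
    where
    y→z : Step y (2 * e) z
    y→z = subst (λ d → Step y d z) (m+n∸m≡n (2 * h₁) (2 * e))
            (step-diverging (m≤m+n (2 * h₁) (2 * e)) (gap≡⇒step {a} p)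
                            (gap≡⇒step {a} (trans q (*-distribˡ-+ 2 h₁ e))))
    gap≡2e : gap y z ≡ 2 * e
    gap≡2e = gap-unique (2*h<n (≤-trans (jump≤ jump) 2s+t≤2[2s+t])) y→z
    e+h≡0 : ∀ {h} → gap z y ≡ 2 * h → Near h → e + h ≡ 0
    e+h≡0 {h} r near = short-loop
      (subst (λ d → Step y d y) (sym (*-distribˡ-+ 2 e h)) (step-trans y→z (gap≡⇒step r)))
      (≤-trans (+-mono-≤ (jump≤ jump) (near≤ near)) 3[2s+t]≤6[2s+t])
      where
      3[2s+t]≤6[2s+t] : 2 * s + t + 2 * (2 * s + t) ≤ 2 * (3 * (2 * s + t))
      3[2s+t]≤6[2s+t] = m+k≡n⇒m≤n (3 * (2 * s + t)) (solve (s ∷ t ∷ []))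

  data Fibre (σ : ℕ) : ℕ → Set where
    low   : σ < s → Fibre σ σ
    mid   : σ ≤ s → Fibre σ (σ + (s + t))
    high  : s < σ → σ ≤ 2 * s → Fibre σ (σ + (s + 2 * t + 1))
    high⁺ : s < σ → σ ≤ 2 * s → Fibre σ (σ + (s + 2 * t + 1) + s)

  fibre≤ : ∀ {σ h} → Fibre σ h → σ ≤ 2 * s
  fibre≤ (low σ<s)    = ≤-trans (<⇒≤ σ<s) s≤2s
  fibre≤ (mid σ≤s)    = ≤-trans σ≤s s≤2s
  fibre≤ (high _ σ≤)  = σ≤
  fibre≤ (high⁺ _ σ≤) = σ≤

  fibre-pair : ∀ {σ h₁ h₂} → Fibre σ h₁ → Fibre σ h₂ →
               h₁ ≡ h₂ ⊎ Apart h₁ h₂ ⊎ Apart h₂ h₁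
  fibre-pair (low _)      (low _)      = inj₁ refl
  fibre-pair (low _)      (mid _)      = inj₂ (inj₁ (s + t , inj₂ refl , refl))
  fibre-pair (mid _)      (low _)      = inj₂ (inj₂ (s + t , inj₂ refl , refl))
  fibre-pair (mid _)      (mid _)      = inj₁ refl
  fibre-pair (high _ _)   (high _ _)   = inj₁ refl
  fibre-pair (high _ _)   (high⁺ _ _)  = inj₂ (inj₁ (s , inj₁ refl , refl))
  fibre-pair (high⁺ _ _)  (high _ _)   = inj₂ (inj₂ (s , inj₁ refl , refl))
  fibre-pair (high⁺ _ _)  (high⁺ _ _)  = inj₁ refl
  fibre-pair (low σ<s)    (high s<σ _)  = contradiction s<σ (<-asym σ<s)
  fibre-pair (low σ<s)    (high⁺ s<σ _) = contradiction s<σ (<-asym σ<s)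
  fibre-pair (high s<σ _)  (low σ<s)    = contradiction s<σ (<-asym σ<s)
  fibre-pair (high⁺ s<σ _) (low σ<s)    = contradiction s<σ (<-asym σ<s)
  fibre-pair (mid σ≤s)    (high s<σ _)  = contradiction σ≤s (<⇒≱ s<σ)
  fibre-pair (mid σ≤s)    (high⁺ s<σ _) = contradiction σ≤s (<⇒≱ s<σ)
  fibre-pair (high s<σ _)  (mid σ≤s)    = contradiction σ≤s (<⇒≱ s<σ)
  fibre-pair (high⁺ s<σ _) (mid σ≤s)    = contradiction σ≤s (<⇒≱ s<σ)

  near-middle : ∀ {h} → Near h → ¬ h < s → h ≤ 2 * s + t → s + t < h
  near-middle (difference h<s)        h≮s _  = contradiction h<s h≮s
  near-middle (connection (s+t<h , _)) _   _  = s+t<h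
  near-middle (sum lo _)              _   h≤ = contradiction (≤-trans lo h≤) (<⇒≱ 2s+t<2[1+s+t])
    where
    2s+t<2[1+s+t] : 2 * s + t < 2 * suc (s + t)
    2s+t<2[1+s+t] = m+k≡n⇒m≤n (suc t) (solve (s ∷ t ∷ []))

  near-top : ∀ {h} → Near h → ¬ h ≤ 2 * s + t → 2 * suc (s + t) ≤ h × h ≤ 2 * (2 * s + t)
  near-top (difference h<s)        h≰ = contradiction (≤-trans (<⇒≤ h<s) s≤2s+t) h≰
  near-top (connection (_ , h≤))   h≰ = contradiction h≤ h≰
  near-top (sum lo hi)             _  = lo , hi

  slot : ℕ → ℕ
  slot h with h <? s | h ≤? 2 * s + t | h ∸ 2 * suc (s + t) <? s
  ... | yes _ | _     | _     = h
  ... | no _  | yes _ | _     = h ∸ (s + t)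
  ... | no _  | no _  | yes _ = suc (s + (h ∸ 2 * suc (s + t)))
  ... | no _  | no _  | no _  = suc (h ∸ 2 * suc (s + t))

  mid-fibre : ∀ {h} → s + t < h → h ≤ 2 * s + t → Fibre (h ∸ (s + t)) h
  mid-fibre {h} s+t<h h≤ =
    subst (Fibre (h ∸ (s + t))) (m∸n+n≡m (<⇒≤ s+t<h))
          (mid (m≤n+o⇒m∸n≤o h (s + t) (subst (h ≤_) 2s+t≡s+t+s h≤)))
    where
    2s+t≡s+t+s : 2 * s + t ≡ s + t + s
    2s+t≡s+t+s = solve (s ∷ t ∷ [])

  high-fibre : ∀ i → i < s → Fibre (suc (s + i)) (i + 2 * suc (s + t))
  high-fibre i i<s = subst (Fibre (suc (s + i))) index≡ (high (s≤s (m≤m+n s i)) σ≤2s)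
    where
    index≡ : suc (s + i) + (s + 2 * t + 1) ≡ i + 2 * suc (s + t)
    index≡ = solve (i ∷ s ∷ t ∷ [])
    σ≤2s : suc (s + i) ≤ 2 * s
    σ≤2s = subst (suc (s + i) ≤_) (cong (s +_) (sym (+-identityʳ s))) (+-monoʳ-< s i<s)

  high⁺-fibre : ∀ i → s ≤ i → i + 2 * suc (s + t) ≤ 2 * (2 * s + t) →
                Fibre (suc i) (i + 2 * suc (s + t))
  high⁺-fibre i s≤i i+2[1+s+t]≤ = subst (Fibre (suc i)) index≡ (high⁺ (s≤s s≤i) σ≤2s)
    where
    index≡ : suc i + (s + 2 * t + 1) + s ≡ i + 2 * suc (s + t)
    index≡ = solve (i ∷ s ∷ t ∷ [])
    top : suc (2 * (2 * s + t)) ≤ 2 * s + 2 * suc (s + t)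
    top = m+k≡n⇒m≤n 1 (solve (s ∷ t ∷ []))
    σ≤2s : suc i ≤ 2 * s
    σ≤2s = +-cancelʳ-≤ (2 * suc (s + t)) (suc i) (2 * s) (≤-trans (s≤s i+2[1+s+t]≤) top)

  slot-fibre : ∀ {h} → Near h → Fibre (slot h) h
  slot-fibre {h} near with h <? s | h ≤? 2 * s + t | h ∸ 2 * suc (s + t) <? s
  ... | yes h<s | _      | _       = low h<s
  ... | no h≮s  | yes h≤ | _       = mid-fibre (near-middle near h≮s h≤) h≤
  ... | no _    | no h≰  | yes i<s =
    subst (Fibre _) (m∸n+n≡m (proj₁ (near-top near h≰))) (high-fibre _ i<s)
  ... | no _    | no h≰  | no i≮s  =
    subst (Fibre _) (m∸n+n≡m lo)
          (high⁺-fibre _ (≮⇒≥ i≮s) (subst (_≤ 2 * (2 * s + t)) (sym (m∸n+n≡m lo)) hi))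
    where
    lo : 2 * suc (s + t) ≤ h
    lo = proj₁ (near-top near h≰)
    hi : h ≤ 2 * (2 * s + t)
    hi = proj₂ (near-top near h≰)

  comparable-set-size : (vs : List (Fin n)) → Unique vs →
    (∀ {u v} → u ∈ vs → v ∈ vs → u ⇝ v ⊎ v ⇝ u) → length vs ≤ suc (2 * s)
  comparable-set-size [] _ _ = z≤n
  comparable-set-size (x ∷ xs) unique comparable
    with ∃-least _⇝_ (λ y → ⇝-refl {y}) ⇝-cycle x xs comparable
  ... | a , _ , a⇝ = length≤-injectiveOn (λ y → slot (gap a y / 2)) unique slot< slot-injective
    where
    slot≡ : ∀ {y h} → gap a y ≡ 2 * h → slot (gap a y / 2) ≡ slot h
    slot≡ p = cong slot (/2-twice p)

    slot< : ∀ {y} → y ∈ x ∷ xs → slot (gap a y / 2) < suc (2 * s)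
    slot< y∈ with a⇝ y∈
    ... | h , p , near = subst (_< suc (2 * s)) (sym (slot≡ p)) (s≤s (fibre≤ (slot-fibre near)))

    slot-injective : ∀ {y z} → y ∈ x ∷ xs → z ∈ x ∷ xs →
                     slot (gap a y / 2) ≡ slot (gap a z / 2) → y ≡ z
    slot-injective {y} {z} y∈ z∈ eq with a⇝ y∈ | a⇝ z∈
    ... | h₁ , p₁ , near₁ | h₂ , p₂ , near₂
      with fibre-pair (slot-fibre near₁)
             (subst (λ σ → Fibre σ h₂) (trans (sym (slot≡ p₂)) (trans (sym eq) (slot≡ p₁)))
                    (slot-fibre near₂))
    ... | inj₁ refl         = gap-injectiveʳ {a} (trans p₁ (sym p₂))
    ... | inj₂ (inj₁ apart) =
      contradiction (comparable y∈ z∈) (apart⇒incomparable {a} {y} {z} p₁ p₂ apart)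
    ... | inj₂ (inj₂ apart) =
      contradiction (comparable z∈ y∈) (apart⇒incomparable {a} {z} {y} p₂ p₁ apart)

  diameter-two-size : ∀ {G : Fin n → Fin n → Set} → (∀ x y → G x y → Adjacent x y) →
                      (H : Subgraph G) → DiameterTwo H → length (Subgraph.verts H) ≤ suc (2 * s)
  diameter-two-size G⇒adjacent H diameter-two = comparable-set-size verts distinct comparable
    where
    open Subgraph H
    comparable : ∀ {u v} → u ∈ verts → v ∈ verts → u ⇝ v ⊎ v ⇝ u
    comparable {u} {v} u∈ v∈ with diameter-two u v u∈ v∈
    ... | inj₁ refl                = inj₁ (⇝-refl {u})
    ... | inj₂ (inj₁ uv)           = adjacent⇒comparable {u} {v} (G⇒adjacent u v (edge-G uv))
    ... | inj₂ (inj₂ (w , uw , wv)) =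
      path⇒comparable {u} {w} {v} (G⇒adjacent u w (edge-G uw)) (G⇒adjacent w v (edge-G wv))

connection-set-halves : ∀ r s {d} → Sset ((2 * (suc (suc r) * 3)) / 3) s d →
                        Twice (λ h → s + r * s < h × h ≤ 2 * s + r * s) d
connection-set-halves r s {d} d∈S =
  Sset⇒Twice {2 * suc r} {s} {s + r * s} {2 * s + r * s} lo≡ hi≡ (subst (λ j → Sset j s d) j≡ d∈S)
  where
  2k≡j*3 : 2 * (suc (suc r) * 3) ≡ suc (suc (2 * suc r)) * 3
  2k≡j*3 = solve (r ∷ [])
  j≡ : (2 * (suc (suc r) * 3)) / 3 ≡ suc (suc (2 * suc r))
  j≡ = trans (cong (_/ 3) 2k≡j*3) (m*n/n≡m (suc (suc (2 * suc r))) 3)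
  lo≡ : 2 * suc r * s + 2 ≡ 2 * suc (s + r * s)
  lo≡ = solve (r ∷ s ∷ [])
  hi≡ : suc (suc (2 * suc r)) * s ≡ 2 * (2 * s + r * s)
  hi≡ = solve (r ∷ s ∷ [])

lemma10 : (k s : ℕ) → 6 ≤ k → 3 ∣ k → 1 ≤ s →
    (H : Subgraph (D k s)) → DiameterTwo H →
    ¬ (2 * s + 5 < length (Subgraph.verts H))
lemma10 _ s 6≤k (divides zero refl)       _ _ _ = contradiction 6≤k λ ()
lemma10 _ s 6≤k (divides (suc zero) refl) _ _ _ = contradiction 6≤k λ { (s≤s (s≤s (s≤s ()))) }
lemma10 _ s _   (divides (suc (suc r)) refl) 0<s H diameter-two =
  ≤⇒≯ (≤-trans (diameter-two-size D⇒adjacent H diameter-two) 2s+1≤2s+5)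
  where
  2sk≡6[2s+t] : 2 * s * (suc (suc r) * 3) ≡ 2 * (3 * (2 * s + r * s))
  2sk≡6[2s+t] = solve (r ∷ s ∷ [])
  open HalfGaps s (r * s) (suc (2 * s * (suc (suc r) * 3))) 0<s (cong suc 2sk≡6[2s+t])
  D⇒adjacent : ∀ x y → D (suc (suc r) * 3) s x y → Adjacent x y
  D⇒adjacent _ _ (inj₁ d∈S) = inj₁ (connection-set-halves r s d∈S)
  D⇒adjacent _ _ (inj₂ d∈S) = inj₂ (connection-set-halves r s d∈S)
  2s+1≤2s+5 : suc (2 * s) ≤ 2 * s + 5
  2s+1≤2s+5 = m+k≡n⇒m≤n 4 (solve (s ∷ []))
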